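{- Let $k\ge1$ and integers $1\le a_1<a_2<\cdots<a_k$. For each $i$ let $S_i=2\,1^{a_i-1}\,2$ (the string consisting of a $2$, then $a_i-1$ ones, then a $2$). Let $$V(x,q)=\sum_{\sigma}x^{w(\sigma)}q^{\ell(\sigma)},$$ where the sum runs over all compositions $\sigma$ (including the empty composition, contributing $1$) with parts in $\mathbb{N}=\{1,2,\ldots\}$ that contain none of $S_1,\ldots,S_k$ as a substring. Then $$V(x,q)=\frac{(1-x)\Big(1+x\sum_{i=1}^{k}(xq)^{a_i}\Big)}{\big(1-x(1+q)+(1-x)x^2q\big)\Big(1+x\sum_{i=1}^{k}(xq)^{a_i}\Big)-(1-x)x^2q}.$$
   Context: A composition $\sigma=\sigma_1\cdots\sigma_m$ is a finite string of positive integers; its weight is $w(\sigma)=\sigma_1+\cdots+\sigma_m$ and its length is $\ell(\sigma)=m$. A string $s_1\cdots s_m$ contains the substring $b_1\cdots b_r$ if there is $i$ with $s_i\cdots s_{i+r-1}=b_1\cdots b_r$. $1^j$ denotes the string of $j$ ones. -}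

module Defs where

open import Data.Nat using (ℕ; zero; suc; _≟_)
open import Data.Integer as ℤ using (ℤ; +_)
open import Data.Nat.ListAction using (sum)
open import Data.List using (List; []; _∷_; _++_; [_]; replicate; length; filter; map; concatMap; upTo)
open import Data.List.Relation.Unary.All using (All; all?)
open import Data.List.Relation.Binary.Infix.Heterogeneous using (Infix)
open import Data.List.Relation.Binary.Infix.Heterogeneous.Properties using (infix?)
open import Data.Fin using (Fin; zero; suc)
open import Data.Product using (_×_)
open import Relation.Binary.PropositionalEquality using (_≡_)
open import Relation.Nullary using (¬_; Dec)
open import Relation.Nullary.Decidable using (_×-dec_; ¬?)
open import Data.Bool using (if_then_else_; _∧_)
open import Relation.Nullary.Decidable using (⌊_⌋)

Contains : List ℕ → List ℕ → Set
Contains s b = Infix _≡_ b s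

contains? : (s b : List ℕ) → Dec (Contains s b)
contains? s b = infix? _≟_ b s

S : ℕ → List ℕ
S a = 2 ∷ replicate (Data.Nat._∸_ a 1) 1 ++ [ 2 ]

forbidden : ∀ {k} → (Fin k → ℕ) → List (List ℕ)
forbidden {zero}  a = []
forbidden {suc k} a = S (a zero) ∷ forbidden (λ i → a (suc i))

Avoids : ∀ {k} → (Fin k → ℕ) → List ℕ → Set
Avoids a σ = All (λ b → ¬ Contains σ b) (forbidden a)

avoids? : ∀ {k} (a : Fin k → ℕ) (σ : List ℕ) → Dec (Avoids a σ)
avoids? a σ = all? (λ b → ¬? (contains? σ b)) (forbidden a)

words : ℕ → List ℕ → List (List ℕ)
words zero    xs = [ [] ]
words (suc m) xs = concatMap (λ x → map (x ∷_) (words m xs)) xs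

compositions : ℕ → ℕ → List (List ℕ)
compositions n m = filter (λ σ → sum σ ≟ n) (words m (map suc (upTo n)))

avoidCount : ∀ {k} → (Fin k → ℕ) → ℕ → ℕ → ℕ
avoidCount a n m = length (filter (avoids? a) (compositions n m))

-- Formal power series in x, q with integer coefficients:
-- f n m = coefficient of x^n q^m

Series : Set
Series = ℕ → ℕ → ℤ

V : ∀ {k} → (Fin k → ℕ) → Series
V a n m = + avoidCount a n m

mono : ℕ → ℕ → Series
mono i j n m = if ⌊ i ≟ n ⌋ ∧ ⌊ j ≟ m ⌋ then + 1 else + 0

oneₛ X Q : Series
oneₛ = mono 0 0
X = mono 1 0
Q = mono 0 1

infixl 6 _+ₛ_ _-ₛ_
infixl 7 _*ₛ_
infixr 8 _^ₛ_

_+ₛ_ : Series → Series → Series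
(f +ₛ g) n m = f n m ℤ.+ g n m

_-ₛ_ : Series → Series → Series
(f -ₛ g) n m = f n m ℤ.- g n m

sumℤ : List ℤ → ℤ
sumℤ []       = + 0
sumℤ (z ∷ zs) = z ℤ.+ sumℤ zs

_*ₛ_ : Series → Series → Series
(f *ₛ g) n m =
  sumℤ (map (λ i → sumℤ (map (λ j → f i j ℤ.* g (Data.Nat._∸_ n i) (Data.Nat._∸_ m j))
                              (upTo (suc m))))
            (upTo (suc n)))

_^ₛ_ : Series → ℕ → Series
f ^ₛ zero  = oneₛ
f ^ₛ suc e = f *ₛ (f ^ₛ e)

sumFin : ∀ {k} → (Fin k → Series) → Series
sumFin {zero}  f = mono 0 0 -ₛ mono 0 0
sumFin {suc k} f = f zero +ₛ sumFin (λ i → f (suc i))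

B : ∀ {k} → (Fin k → ℕ) → Series
B a = oneₛ +ₛ X *ₛ sumFin (λ i → (X *ₛ Q) ^ₛ a i)

Num : ∀ {k} → (Fin k → ℕ) → Series
Num a = (oneₛ -ₛ X) *ₛ B a

Den : ∀ {k} → (Fin k → ℕ) → Series
Den a = (oneₛ -ₛ X *ₛ (oneₛ +ₛ Q) +ₛ (oneₛ -ₛ X) *ₛ (X ^ₛ 2) *ₛ Q) *ₛ B a
        -ₛ (oneₛ -ₛ X) *ₛ (X ^ₛ 2) *ₛ Q

module Submission where

-- Let F be the series of the avoiding compositions, H the part of F coming
-- from compositions that begin with 2, and K = Σ_{p ≥ 1, p ≠ 2} x^p q.
-- Since every S_a begins with 2:
--   (1) F = 1 + K F + H                  (split off the first part);
--   (2) (1 - x) K = xq - x²q + x³q       (K is a geometric series minus x²q);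
--   (3) H (1 + x Σ_i (xq)^{a_i}) = x²q F: prepending 2 to an avoiding word w
--       gives an avoiding word unless w begins with a block 1^{a_i - 1} 2,
--       which then is unique, and those w contribute x^{a_i - 1} q^{a_i - 1} H.
-- Eliminating H and K from (1)–(3) gives F · Den = Num.

open import Defs
open import Data.Nat using (ℕ; suc; _≤_; _<_)
open import Data.Fin using (Fin)
open import Relation.Binary.PropositionalEquality using (_≡_; sym)
open import Relation.Binary.Definitions using (tri<; tri≈; tri>)
import Data.Fin.Properties
import Data.Nat.Properties
open import Data.Empty using (⊥-elim)

module FiniteSums where

  open import Data.Nat as ℕ using (zero; z≤n; s≤s; _∸_)
  import Data.Nat.Properties as ℕP
  open import Data.Integer using (ℤ; 0ℤ; 1ℤ; _+_; _*_)
  import Data.Integer.Properties as ℤP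
  open import Data.List using (map; applyUpTo; upTo)
  open import Data.Bool using (Bool; true; false)
  open import Data.Bool.Properties using (¬-not)
  open import Data.Fin using (Fin) renaming (zero to fzero; suc to fsuc)
  import Data.Fin.Properties as FinP
  open import Function using (_∘_)
  open import Relation.Binary.PropositionalEquality
  open import Algebra.Properties.CommutativeSemigroup ℤP.+-commutativeSemigroup
    using (interchange)
  open ≡-Reasoning

  ∑ : ℕ → (ℕ → ℤ) → ℤ
  ∑ zero    f = 0ℤ
  ∑ (suc n) f = f 0 + ∑ n (λ i → f (suc i))

  sumℤ-applyUpTo : ∀ (f : ℕ → ℤ) (g : ℕ → ℕ) n →
                   sumℤ (map f (applyUpTo g n)) ≡ ∑ n (λ i → f (g i))
  sumℤ-applyUpTo f g zero    = refl
  sumℤ-applyUpTo f g (suc n) = cong (f (g 0) +_) (sumℤ-applyUpTo f (λ i → g (suc i)) n)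

  sumℤ-upTo : ∀ (f : ℕ → ℤ) n → sumℤ (map f (upTo n)) ≡ ∑ n f
  sumℤ-upTo f = sumℤ-applyUpTo f (λ i → i)

  ∑-cong : ∀ {f g : ℕ → ℤ} n → (∀ i → i ℕ.< n → f i ≡ g i) → ∑ n f ≡ ∑ n g
  ∑-cong zero    h = refl
  ∑-cong (suc n) h = cong₂ _+_ (h 0 (s≤s z≤n)) (∑-cong n (λ i i<n → h (suc i) (s≤s i<n)))

  ∑-cong′ : ∀ {f g : ℕ → ℤ} n → (∀ i → f i ≡ g i) → ∑ n f ≡ ∑ n g
  ∑-cong′ n h = ∑-cong n (λ i _ → h i)

  ∑-+ : ∀ (f g : ℕ → ℤ) n → ∑ n (λ i → f i + g i) ≡ ∑ n f + ∑ n g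
  ∑-+ f g zero    = refl
  ∑-+ f g (suc n) =
    trans (cong (f 0 + g 0 +_) (∑-+ (λ i → f (suc i)) (λ i → g (suc i)) n))
          (interchange (f 0) (g 0) _ _)

  ∑-zero : ∀ {f : ℕ → ℤ} n → (∀ i → i ℕ.< n → f i ≡ 0ℤ) → ∑ n f ≡ 0ℤ
  ∑-zero zero    h = refl
  ∑-zero (suc n) h = cong₂ _+_ (h 0 (s≤s z≤n)) (∑-zero n (λ i i<n → h (suc i) (s≤s i<n)))

  ∑-*ˡ : ∀ c (f : ℕ → ℤ) n → c * ∑ n f ≡ ∑ n (λ i → c * f i)
  ∑-*ˡ c f zero    = ℤP.*-zeroʳ c
  ∑-*ˡ c f (suc n) =
    trans (ℤP.*-distribˡ-+ c (f 0) _) (cong (c * f 0 +_) (∑-*ˡ c (λ i → f (suc i)) n))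

  ∑-*ʳ : ∀ c (f : ℕ → ℤ) n → ∑ n f * c ≡ ∑ n (λ i → f i * c)
  ∑-*ʳ c f zero    = ℤP.*-zeroˡ c
  ∑-*ʳ c f (suc n) =
    trans (ℤP.*-distribʳ-+ c (f 0) _) (cong (f 0 * c +_) (∑-*ʳ c (λ i → f (suc i)) n))

  ∑-swap : ∀ (F : ℕ → ℕ → ℤ) n m →
           ∑ n (λ i → ∑ m (λ j → F i j)) ≡ ∑ m (λ j → ∑ n (λ i → F i j))
  ∑-swap F zero    m = sym (∑-zero m (λ _ _ → refl))
  ∑-swap F (suc n) m =
    trans (cong (∑ m (F 0) +_) (∑-swap (λ i → F (suc i)) n m))
          (sym (∑-+ (F 0) (λ j → ∑ n (λ i → F (suc i) j)) m))

  ∑-last : ∀ (f : ℕ → ℤ) n → ∑ (suc n) f ≡ ∑ n f + f n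
  ∑-last f zero    = trans (ℤP.+-identityʳ (f 0)) (sym (ℤP.+-identityˡ (f 0)))
  ∑-last f (suc n) =
    trans (cong (f 0 +_) (∑-last (λ i → f (suc i)) n)) (sym (ℤP.+-assoc (f 0) _ _))

  ∑-reverse : ∀ (f : ℕ → ℤ) n → ∑ n f ≡ ∑ n (λ i → f (n ∸ suc i))
  ∑-reverse f zero    = refl
  ∑-reverse f (suc n) = begin
    f 0 + ∑ n (λ i → f (suc i))               ≡⟨ cong (f 0 +_) (∑-reverse (λ i → f (suc i)) n) ⟩
    f 0 + ∑ n (λ i → f (suc (n ∸ suc i)))     ≡⟨ ℤP.+-comm (f 0) _ ⟩
    ∑ n (λ i → f (suc (n ∸ suc i))) + f 0     ≡⟨ cong₂ _+_ (∑-cong n (λ i i<n → cong f (sym (ℕP.+-∸-assoc 1 i<n))))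
                                                           (cong f (sym (ℕP.n∸n≡0 n))) ⟩
    ∑ n (λ i → f (n ∸ i)) + f (n ∸ n)         ≡⟨ sym (∑-last (λ i → f (n ∸ i)) n) ⟩
    ∑ (suc n) (λ i → f (n ∸ i))               ∎

  ∑-truncate : ∀ (f : ℕ → ℤ) n N → n ℕ.≤ N → (∀ i → n ℕ.≤ i → f i ≡ 0ℤ) → ∑ N f ≡ ∑ n f
  ∑-truncate f zero    N       _         h = ∑-zero N (λ i _ → h i z≤n)
  ∑-truncate f (suc n) (suc N) (s≤s n≤N) h =
    cong (f 0 +_) (∑-truncate (λ i → f (suc i)) n N n≤N (λ i n≤i → h (suc i) (s≤s n≤i)))

  -- Reindexing a triangle: the pairs (i', i - i') with i' ≤ i ≤ n are the
  -- pairs (i', t) with i' + t ≤ n.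
  ∑-triangle : ∀ (F : ℕ → ℕ → ℕ → ℤ) n →
    ∑ (suc n) (λ i → ∑ (suc i) (λ i' → F i' (i ∸ i') (n ∸ i))) ≡
    ∑ (suc n) (λ i' → ∑ (suc (n ∸ i')) (λ t → F i' t (n ∸ i' ∸ t)))
  ∑-triangle F zero    = refl
  ∑-triangle F (suc n) = begin
    (F 0 0 (suc n) + 0ℤ) + ∑ (suc n) (λ i → F 0 (suc i) (n ∸ i) + Rest i)
      ≡⟨ cong (F 0 0 (suc n) + 0ℤ +_) (∑-+ (λ i → F 0 (suc i) (n ∸ i)) Rest (suc n)) ⟩
    (F 0 0 (suc n) + 0ℤ) + (First + ∑ (suc n) Rest)
      ≡⟨ cong (λ z → F 0 0 (suc n) + 0ℤ + (First + z)) (∑-triangle (λ i' → F (suc i')) n) ⟩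
    (F 0 0 (suc n) + 0ℤ) + (First + Rest′)
      ≡⟨ sym (ℤP.+-assoc (F 0 0 (suc n) + 0ℤ) First Rest′) ⟩
    (F 0 0 (suc n) + 0ℤ + First) + Rest′
      ≡⟨ cong (λ z → z + First + Rest′) (ℤP.+-identityʳ (F 0 0 (suc n))) ⟩
    F 0 0 (suc n) + First + Rest′ ∎
    where
    Rest : ℕ → ℤ
    Rest i = ∑ (suc i) (λ i' → F (suc i') (i ∸ i') (n ∸ i))
    First Rest′ : ℤ
    First = ∑ (suc n) (λ i → F 0 (suc i) (n ∸ i))
    Rest′ = ∑ (suc n) (λ i' → ∑ (suc (n ∸ i')) (λ t → F (suc i') t (n ∸ i' ∸ t)))

  -- The indicator  δ k i = [k = i]  and  restrict k n z = [k < n] · z.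
  δ : ℕ → ℕ → ℤ
  δ zero    zero    = 1ℤ
  δ zero    (suc i) = 0ℤ
  δ (suc k) zero    = 0ℤ
  δ (suc k) (suc i) = δ k i

  restrict : ℕ → ℕ → ℤ → ℤ
  restrict k       zero    z = 0ℤ
  restrict zero    (suc n) z = z
  restrict (suc k) (suc n) z = restrict k n z

  ∑-δ : ∀ k n (g : ℕ → ℤ) → ∑ n (λ i → δ k i * g i) ≡ restrict k n (g k)
  ∑-δ k       zero    g = refl
  ∑-δ zero    (suc n) g =
    trans (cong₂ _+_ (ℤP.*-identityˡ (g 0)) (∑-zero n (λ i _ → ℤP.*-zeroˡ (g (suc i)))))
          (ℤP.+-identityʳ (g 0))
  ∑-δ (suc k) (suc n) g =
    trans (cong₂ _+_ (ℤP.*-zeroˡ (g 0)) (∑-δ k n (λ i → g (suc i)))) (ℤP.+-identityˡ _)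

  ∑-single : ∀ j n (f : ℕ → ℤ) → (∀ i → i ≢ j → f i ≡ 0ℤ) → ∑ n f ≡ restrict j n (f j)
  ∑-single j       zero    f h = refl
  ∑-single zero    (suc n) f h =
    trans (cong (f 0 +_) (∑-zero n (λ i _ → h (suc i) (λ ())))) (ℤP.+-identityʳ (f 0))
  ∑-single (suc j) (suc n) f h =
    trans (cong₂ _+_ (h 0 (λ ())) (∑-single j n (λ i → f (suc i)) (λ i i≢j → h (suc i) (i≢j ∘ cong ℕ.pred))))
          (ℤP.+-identityˡ _)

  restrict-0 : ∀ k n → restrict k n 0ℤ ≡ 0ℤ
  restrict-0 k       zero    = refl
  restrict-0 zero    (suc n) = refl
  restrict-0 (suc k) (suc n) = restrict-0 k n

  𝟙ᵇ : Bool → ℤ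
  𝟙ᵇ true  = 1ℤ
  𝟙ᵇ false = 0ℤ

  ∑Fin : ∀ {k} → (Fin k → ℤ) → ℤ
  ∑Fin {zero}  f = 0ℤ
  ∑Fin {suc k} f = f fzero + ∑Fin (λ i → f (fsuc i))

  ∑Fin-cong : ∀ {k} {f g : Fin k → ℤ} → (∀ i → f i ≡ g i) → ∑Fin f ≡ ∑Fin g
  ∑Fin-cong {zero}  h = refl
  ∑Fin-cong {suc k} h = cong₂ _+_ (h fzero) (∑Fin-cong (λ i → h (fsuc i)))

  ∑Fin-zero : ∀ {k} (f : Fin k → ℤ) → (∀ i → f i ≡ 0ℤ) → ∑Fin f ≡ 0ℤ
  ∑Fin-zero {zero}  f h = refl
  ∑Fin-zero {suc k} f h = cong₂ _+_ (h fzero) (∑Fin-zero (λ i → f (fsuc i)) (λ i → h (fsuc i)))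

  ∑Fin-unique : ∀ {k} (b : Fin k → Bool) → (∀ i j → b i ≡ true → b j ≡ true → i ≡ j) →
    (i₀ : Fin k) → b i₀ ≡ true → ∑Fin (λ i → 𝟙ᵇ (b i)) ≡ 1ℤ
  ∑Fin-unique {suc k} b unique fzero b₀ rewrite b₀ =
    cong (1ℤ +_) (∑Fin-zero (λ i → 𝟙ᵇ (b (fsuc i))) rest)
    where
    rest : ∀ i → 𝟙ᵇ (b (fsuc i)) ≡ 0ℤ
    rest i = cong 𝟙ᵇ (¬-not (λ bᵢ → FinP.0≢1+n (unique fzero (fsuc i) b₀ bᵢ)))
  ∑Fin-unique {suc k} b unique (fsuc i₀) bᵢ₀ =
    trans (cong (_+ ∑Fin (λ i → 𝟙ᵇ (b (fsuc i)))) first)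
    (trans (ℤP.+-identityˡ _)
           (∑Fin-unique (λ i → b (fsuc i))
              (λ i j p q → FinP.suc-injective (unique (fsuc i) (fsuc j) p q)) i₀ bᵢ₀))
    where
    first : 𝟙ᵇ (b fzero) ≡ 0ℤ
    first = cong 𝟙ᵇ (¬-not (λ b₀ → FinP.0≢1+n (unique fzero (fsuc i₀) b₀ bᵢ₀)))

module SeriesRing where

  open import Data.Nat as ℕ using (zero; _∸_)
  import Data.Nat.Properties as ℕP
  open import Data.Integer using (ℤ; 0ℤ; 1ℤ; -_; _+_; _*_)
  import Data.Integer.Properties as ℤP
  open import Data.List using (map; upTo)
  open import Data.Fin using (Fin) renaming (zero to fzero; suc to fsuc)
  open import Data.Bool using (true; false; _∧_; if_then_else_)
  open import Data.Product using (_,_)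
  open import Relation.Nullary.Decidable using (isYes≗does)
  open import Relation.Binary.PropositionalEquality
  open import Relation.Binary.Structures using (IsEquivalence)
  open import Algebra.Structures using (IsCommutativeRing)
  open import Algebra.Bundles using (CommutativeRing)
  open FiniteSums
  open ≡-Reasoning

  infix 4 _≈_
  _≈_ : Series → Series → Set
  f ≈ g = ∀ n m → f n m ≡ g n m

  ≈-refl : ∀ {f} → f ≈ f
  ≈-refl _ _ = refl

  ≈-sym : ∀ {f g} → f ≈ g → g ≈ f
  ≈-sym p n m = sym (p n m)

  ≈-trans : ∀ {f g h} → f ≈ g → g ≈ h → f ≈ h
  ≈-trans p q n m = trans (p n m) (q n m)

  zeroₛ : Series
  zeroₛ n m = 0ℤ

  negₛ : Series → Series
  negₛ f n m = - f n m

  *ₛ-coeff : ∀ f g n m →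
    (f *ₛ g) n m ≡ ∑ (suc n) (λ i → ∑ (suc m) (λ j → f i j * g (n ∸ i) (m ∸ j)))
  *ₛ-coeff f g n m =
    trans (sumℤ-upTo (λ i → sumℤ (map (fg i) (upTo (suc m)))) (suc n))
          (∑-cong′ (suc n) (λ i → sumℤ-upTo (fg i) (suc m)))
    where
    fg : ℕ → ℕ → ℤ
    fg i j = f i j * g (n ∸ i) (m ∸ j)

  *ₛ-comm : ∀ f g → f *ₛ g ≈ g *ₛ f
  *ₛ-comm f g n m = begin
    (f *ₛ g) n m
      ≡⟨ *ₛ-coeff f g n m ⟩
    ∑ (suc n) (λ i → ∑ (suc m) (λ j → f i j * g (n ∸ i) (m ∸ j)))
      ≡⟨ ∑-reverse (λ i → ∑ (suc m) (λ j → f i j * g (n ∸ i) (m ∸ j))) (suc n) ⟩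
    ∑ (suc n) (λ i → ∑ (suc m) (λ j → f (n ∸ i) j * g (n ∸ (n ∸ i)) (m ∸ j)))
      ≡⟨ ∑-cong (suc n) (λ i i≤n →
           trans (∑-reverse (λ j → f (n ∸ i) j * g (n ∸ (n ∸ i)) (m ∸ j)) (suc m)) (∑-cong (suc m) (λ j j≤m →
           trans (cong₂ (λ a b → f (n ∸ i) (m ∸ j) * g a b)
                        (ℕP.m∸[m∸n]≡n (ℕP.≤-pred i≤n)) (ℕP.m∸[m∸n]≡n (ℕP.≤-pred j≤m)))
                 (ℤP.*-comm (f (n ∸ i) (m ∸ j)) (g i j))))) ⟩
    ∑ (suc n) (λ i → ∑ (suc m) (λ j → g i j * f (n ∸ i) (m ∸ j)))
      ≡⟨ sym (*ₛ-coeff g f n m) ⟩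
    (g *ₛ f) n m ∎

  -- Both bracketings of a triple product equal the sum of
  -- f i j · g t s · h (n-i-t) (m-j-s) over i + t ≤ n, j + s ≤ m.
  tripleProduct : Series → Series → Series → Series
  tripleProduct f g h n m =
    ∑ (suc n) (λ i → ∑ (suc m) (λ j → ∑ (suc (n ∸ i)) (λ t → ∑ (suc (m ∸ j)) (λ s →
      f i j * g t s * h (n ∸ i ∸ t) (m ∸ j ∸ s)))))

  *ₛ-assocʳ : ∀ f g h → f *ₛ (g *ₛ h) ≈ tripleProduct f g h
  *ₛ-assocʳ f g h n m =
    trans (*ₛ-coeff f (g *ₛ h) n m) (∑-cong′ (suc n) (λ i → ∑-cong′ (suc m) (λ j → pullOut i j)))
    where
    pullOut : ∀ i j → f i j * (g *ₛ h) (n ∸ i) (m ∸ j) ≡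
      ∑ (suc (n ∸ i)) (λ t → ∑ (suc (m ∸ j)) (λ s → f i j * g t s * h (n ∸ i ∸ t) (m ∸ j ∸ s)))
    pullOut i j = begin
      c * (g *ₛ h) (n ∸ i) (m ∸ j)
        ≡⟨ cong (c *_) (*ₛ-coeff g h (n ∸ i) (m ∸ j)) ⟩
      c * ∑ (suc (n ∸ i)) (λ t → ∑ (suc (m ∸ j)) (gh t))
        ≡⟨ ∑-*ˡ c (λ t → ∑ (suc (m ∸ j)) (gh t)) (suc (n ∸ i)) ⟩
      ∑ (suc (n ∸ i)) (λ t → c * ∑ (suc (m ∸ j)) (gh t))
        ≡⟨ ∑-cong′ (suc (n ∸ i)) (λ t → trans (∑-*ˡ c (gh t) (suc (m ∸ j)))
             (∑-cong′ (suc (m ∸ j)) (λ s → sym (ℤP.*-assoc c (g t s) (h (n ∸ i ∸ t) (m ∸ j ∸ s)))))) ⟩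
      ∑ (suc (n ∸ i)) (λ t → ∑ (suc (m ∸ j)) (λ s → c * g t s * h (n ∸ i ∸ t) (m ∸ j ∸ s))) ∎
      where
      c : ℤ
      c = f i j
      gh : ℕ → ℕ → ℤ
      gh t s = g t s * h (n ∸ i ∸ t) (m ∸ j ∸ s)

  *ₛ-assocˡ : ∀ f g h → (f *ₛ g) *ₛ h ≈ tripleProduct f g h
  *ₛ-assocˡ f g h n m = begin
    ((f *ₛ g) *ₛ h) n m
      ≡⟨ *ₛ-coeff (f *ₛ g) h n m ⟩
    ∑ (suc n) (λ i → ∑ (suc m) (λ j → (f *ₛ g) i j * h (n ∸ i) (m ∸ j)))
      ≡⟨ ∑-cong′ (suc n) (λ i → ∑-cong′ (suc m) (λ j → expand i j)) ⟩
    ∑ (suc n) (λ i → ∑ (suc m) (λ j → ∑ (suc i) (λ i' → ∑ (suc j) (λ j' →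
      f i' j' * g (i ∸ i') (j ∸ j') * h (n ∸ i) (m ∸ j)))))
      ≡⟨ ∑-cong′ (suc n) (λ i → ∑-swap (λ j i' → ∑ (suc j) (λ j' →
           f i' j' * g (i ∸ i') (j ∸ j') * h (n ∸ i) (m ∸ j))) (suc m) (suc i)) ⟩
    ∑ (suc n) (λ i → ∑ (suc i) (λ i' → ∑ (suc m) (λ j → ∑ (suc j) (λ j' →
      f i' j' * g (i ∸ i') (j ∸ j') * h (n ∸ i) (m ∸ j)))))
      ≡⟨ ∑-triangle (λ i' t u → ∑ (suc m) (λ j → ∑ (suc j) (λ j' →
           f i' j' * g t (j ∸ j') * h u (m ∸ j)))) n ⟩
    ∑ (suc n) (λ i' → ∑ (suc (n ∸ i')) (λ t → ∑ (suc m) (λ j → ∑ (suc j) (λ j' →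
      f i' j' * g t (j ∸ j') * h (n ∸ i' ∸ t) (m ∸ j)))))
      ≡⟨ ∑-cong′ (suc n) (λ i' → ∑-cong′ (suc (n ∸ i')) (λ t →
           ∑-triangle (λ j' s u → f i' j' * g t s * h (n ∸ i' ∸ t) u) m)) ⟩
    ∑ (suc n) (λ i' → ∑ (suc (n ∸ i')) (λ t → ∑ (suc m) (λ j' → ∑ (suc (m ∸ j')) (λ s →
      f i' j' * g t s * h (n ∸ i' ∸ t) (m ∸ j' ∸ s)))))
      ≡⟨ ∑-cong′ (suc n) (λ i' → ∑-swap (λ t j' → ∑ (suc (m ∸ j')) (λ s →
           f i' j' * g t s * h (n ∸ i' ∸ t) (m ∸ j' ∸ s))) (suc (n ∸ i')) (suc m)) ⟩
    tripleProduct f g h n m ∎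
    where
    expand : ∀ i j → (f *ₛ g) i j * h (n ∸ i) (m ∸ j) ≡
      ∑ (suc i) (λ i' → ∑ (suc j) (λ j' → f i' j' * g (i ∸ i') (j ∸ j') * h (n ∸ i) (m ∸ j)))
    expand i j =
      trans (cong (_* h (n ∸ i) (m ∸ j)) (*ₛ-coeff f g i j))
      (trans (∑-*ʳ c (λ i' → ∑ (suc j) (λ j' → f i' j' * g (i ∸ i') (j ∸ j'))) (suc i))
             (∑-cong′ (suc i) (λ i' → ∑-*ʳ c (λ j' → f i' j' * g (i ∸ i') (j ∸ j')) (suc j))))
      where c = h (n ∸ i) (m ∸ j)

  *ₛ-assoc : ∀ f g h → (f *ₛ g) *ₛ h ≈ f *ₛ (g *ₛ h)
  *ₛ-assoc f g h = ≈-trans (*ₛ-assocˡ f g h) (≈-sym (*ₛ-assocʳ f g h))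

  *ₛ-cong : ∀ {f f′ g g′} → f ≈ f′ → g ≈ g′ → f *ₛ g ≈ f′ *ₛ g′
  *ₛ-cong {f} {f′} {g} {g′} p q n m =
    trans (*ₛ-coeff f g n m)
    (trans (∑-cong′ (suc n) (λ i → ∑-cong′ (suc m) (λ j → cong₂ _*_ (p i j) (q (n ∸ i) (m ∸ j)))))
           (sym (*ₛ-coeff f′ g′ n m)))

  *ₛ-congˡ : ∀ f {g g′} → g ≈ g′ → f *ₛ g ≈ f *ₛ g′
  *ₛ-congˡ f = *ₛ-cong {f} {f} ≈-refl

  *ₛ-congʳ : ∀ {f f′} g → f ≈ f′ → f *ₛ g ≈ f′ *ₛ g
  *ₛ-congʳ g p = *ₛ-cong p (≈-refl {g})

  *ₛ-distribˡ : ∀ f g h → f *ₛ (g +ₛ h) ≈ f *ₛ g +ₛ f *ₛ h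
  *ₛ-distribˡ f g h n m =
    trans (*ₛ-coeff f (g +ₛ h) n m)
    (trans (∑-cong′ (suc n) (λ i →
              trans (∑-cong′ (suc m) (λ j → ℤP.*-distribˡ-+ (f i j) (g (n ∸ i) (m ∸ j)) (h (n ∸ i) (m ∸ j)))) (∑-+ (fg i) (fh i) (suc m))))
    (trans (∑-+ (λ i → ∑ (suc m) (fg i)) (λ i → ∑ (suc m) (fh i)) (suc n))
           (sym (cong₂ _+_ (*ₛ-coeff f g n m) (*ₛ-coeff f h n m)))))
    where
    fg fh : ℕ → ℕ → ℤ
    fg i j = f i j * g (n ∸ i) (m ∸ j)
    fh i j = f i j * h (n ∸ i) (m ∸ j)

  *ₛ-scalar : ∀ c f g → (λ n m → c * f n m) *ₛ g ≈ (λ n m → c * (f *ₛ g) n m)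
  *ₛ-scalar c f g n m =
    trans (*ₛ-coeff (λ n m → c * f n m) g n m)
    (trans (∑-cong′ (suc n) (λ i →
              trans (∑-cong′ (suc m) (λ j → ℤP.*-assoc c (f i j) (g (n ∸ i) (m ∸ j)))) (sym (∑-*ˡ c (fg i) (suc m)))))
    (trans (sym (∑-*ˡ c (λ i → ∑ (suc m) (fg i)) (suc n))) (cong (c *_) (sym (*ₛ-coeff f g n m)))))
    where
    fg : ℕ → ℕ → ℤ
    fg i j = f i j * g (n ∸ i) (m ∸ j)

  δ-≡ᵇ : ∀ i a → δ i a ≡ (if i ℕ.≡ᵇ a then 1ℤ else 0ℤ)
  δ-≡ᵇ zero    zero    = refl
  δ-≡ᵇ zero    (suc a) = refl
  δ-≡ᵇ (suc i) zero    = refl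
  δ-≡ᵇ (suc i) (suc a) = δ-≡ᵇ i a

  mono-δ : ∀ i j a b → mono i j a b ≡ δ i a * δ j b
  mono-δ i j a b
    rewrite isYes≗does (i ℕ.≟ a) | isYes≗does (j ℕ.≟ b) | δ-≡ᵇ i a | δ-≡ᵇ j b
    = indicator-∧ (i ℕ.≡ᵇ a) (j ℕ.≡ᵇ b)
    where
    indicator-∧ : ∀ b c → (if b ∧ c then 1ℤ else 0ℤ) ≡
                          (if b then 1ℤ else 0ℤ) * (if c then 1ℤ else 0ℤ)
    indicator-∧ true  true  = refl
    indicator-∧ true  false = refl
    indicator-∧ false c     = refl

  mono-shift : ∀ i j f n m →
    (mono i j *ₛ f) n m ≡ restrict i (suc n) (restrict j (suc m) (f (n ∸ i) (m ∸ j)))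
  mono-shift i j f n m = begin
    (mono i j *ₛ f) n m
      ≡⟨ *ₛ-coeff (mono i j) f n m ⟩
    ∑ (suc n) (λ a → ∑ (suc m) (λ b → mono i j a b * f (n ∸ a) (m ∸ b)))
      ≡⟨ ∑-cong′ (suc n) (λ a → ∑-cong′ (suc m) (λ b →
           trans (cong (_* f (n ∸ a) (m ∸ b)) (mono-δ i j a b)) (ℤP.*-assoc (δ i a) (δ j b) _))) ⟩
    ∑ (suc n) (λ a → ∑ (suc m) (λ b → δ i a * (δ j b * f (n ∸ a) (m ∸ b))))
      ≡⟨ ∑-cong′ (suc n) (λ a → trans (sym (∑-*ˡ (δ i a) (λ b → δ j b * f (n ∸ a) (m ∸ b)) (suc m)))
                                       (cong (δ i a *_) (∑-δ j (suc m) (λ b → f (n ∸ a) (m ∸ b))))) ⟩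
    ∑ (suc n) (λ a → δ i a * restrict j (suc m) (f (n ∸ a) (m ∸ j)))
      ≡⟨ ∑-δ i (suc n) (λ a → restrict j (suc m) (f (n ∸ a) (m ∸ j))) ⟩
    restrict i (suc n) (restrict j (suc m) (f (n ∸ i) (m ∸ j))) ∎

  *ₛ-identityˡ : ∀ f → oneₛ *ₛ f ≈ f
  *ₛ-identityˡ f = mono-shift 0 0 f

  isCommutativeRing : IsCommutativeRing _≈_ _+ₛ_ _*ₛ_ negₛ zeroₛ oneₛ
  isCommutativeRing = record
    { isRing = record
      { +-isAbelianGroup = record
        { isGroup = record
          { isMonoid = record
            { isSemigroup = record
              { isMagma = record
                { isEquivalence = ≈-isEquivalence
                ; ∙-cong = λ p q n m → cong₂ _+_ (p n m) (q n m) }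
              ; assoc = λ f g h n m → ℤP.+-assoc (f n m) (g n m) (h n m) }
            ; identity = (λ f n m → ℤP.+-identityˡ (f n m)) , (λ f n m → ℤP.+-identityʳ (f n m)) }
          ; inverse = (λ f n m → ℤP.+-inverseˡ (f n m)) , (λ f n m → ℤP.+-inverseʳ (f n m))
          ; ⁻¹-cong = λ p n m → cong -_ (p n m) }
        ; comm = λ f g n m → ℤP.+-comm (f n m) (g n m) }
      ; *-cong = *ₛ-cong
      ; *-assoc = *ₛ-assoc
      ; *-identity = *ₛ-identityˡ , (λ f → ≈-trans (*ₛ-comm f oneₛ) (*ₛ-identityˡ f))
      ; distrib = *ₛ-distribˡ , *ₛ-distribʳ }
    ; *-comm = *ₛ-comm }
    where
    ≈-isEquivalence : IsEquivalence _≈_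
    ≈-isEquivalence = record { refl = ≈-refl ; sym = ≈-sym ; trans = ≈-trans }

    *ₛ-distribʳ : ∀ h f g → (f +ₛ g) *ₛ h ≈ f *ₛ h +ₛ g *ₛ h
    *ₛ-distribʳ h f g n m =
      trans (*ₛ-comm (f +ₛ g) h n m)
      (trans (*ₛ-distribˡ h f g n m) (cong₂ _+_ (*ₛ-comm h f n m) (*ₛ-comm h g n m)))

  seriesRing : CommutativeRing _ _
  seriesRing = record { isCommutativeRing = isCommutativeRing }

  mono-* : ∀ i j k l → mono i j *ₛ mono k l ≈ mono (i ℕ.+ k) (j ℕ.+ l)
  mono-* i j k l n m = begin
    (mono i j *ₛ mono k l) n m
      ≡⟨ mono-shift i j (mono k l) n m ⟩
    restrict i (suc n) (restrict j (suc m) (mono k l (n ∸ i) (m ∸ j)))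
      ≡⟨ cong (λ z → restrict i (suc n) (restrict j (suc m) z)) (mono-δ k l (n ∸ i) (m ∸ j)) ⟩
    restrict i (suc n) (restrict j (suc m) (δ k (n ∸ i) * δ l (m ∸ j)))
      ≡⟨ cong (restrict i (suc n)) (restrict-*ˡ j (suc m) (δ k (n ∸ i)) (δ l (m ∸ j))) ⟩
    restrict i (suc n) (δ k (n ∸ i) * restrict j (suc m) (δ l (m ∸ j)))
      ≡⟨ restrict-*ʳ i (suc n) (δ k (n ∸ i)) (restrict j (suc m) (δ l (m ∸ j))) ⟩
    restrict i (suc n) (δ k (n ∸ i)) * restrict j (suc m) (δ l (m ∸ j))
      ≡⟨ cong₂ _*_ (restrict-δ i k n) (restrict-δ j l m) ⟩
    δ (i ℕ.+ k) n * δ (j ℕ.+ l) m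
      ≡⟨ sym (mono-δ (i ℕ.+ k) (j ℕ.+ l) n m) ⟩
    mono (i ℕ.+ k) (j ℕ.+ l) n m ∎
    where
    restrict-*ˡ : ∀ k n x y → restrict k n (x * y) ≡ x * restrict k n y
    restrict-*ˡ k       zero    x y = sym (ℤP.*-zeroʳ x)
    restrict-*ˡ zero    (suc n) x y = refl
    restrict-*ˡ (suc k) (suc n) x y = restrict-*ˡ k n x y

    restrict-*ʳ : ∀ k n x y → restrict k n (x * y) ≡ restrict k n x * y
    restrict-*ʳ k       zero    x y = refl
    restrict-*ʳ zero    (suc n) x y = refl
    restrict-*ʳ (suc k) (suc n) x y = restrict-*ʳ k n x y

    restrict-δ : ∀ i k n → restrict i (suc n) (δ k (n ∸ i)) ≡ δ (i ℕ.+ k) n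
    restrict-δ zero    k n       = refl
    restrict-δ (suc i) k zero    = refl
    restrict-δ (suc i) k (suc n) = restrict-δ i k n

  XQ^ : ∀ r → (X *ₛ Q) ^ₛ r ≈ mono r r
  XQ^ zero    = ≈-refl
  XQ^ (suc r) = ≈-trans (*ₛ-cong {X *ₛ Q} {mono 1 1} (mono-* 1 0 0 1) (XQ^ r)) (mono-* 1 1 r r)

  X^ : ∀ k → X ^ₛ k ≈ mono k 0
  X^ zero    = ≈-refl
  X^ (suc k) = ≈-trans (*ₛ-congˡ X (X^ k)) (mono-* 1 0 k 0)

  X^Q : ∀ k → (X ^ₛ k) *ₛ Q ≈ mono k 1
  X^Q k = ≈-trans (*ₛ-comm (X ^ₛ k) Q) (≈-trans (*ₛ-congˡ Q (X^ k)) (mono-* 0 1 k 0))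

  sumFin-coeff : ∀ {k} (g : Fin k → Series) n m → sumFin g n m ≡ ∑Fin (λ i → g i n m)
  sumFin-coeff {zero}  g n m = ℤP.+-inverseʳ (oneₛ n m)
  sumFin-coeff {suc k} g n m = cong (g fzero n m +_) (sumFin-coeff (λ i → g (fsuc i)) n m)

  sumFin-cong : ∀ {k} {g g′ : Fin k → Series} → (∀ i → g i ≈ g′ i) → sumFin g ≈ sumFin g′
  sumFin-cong {zero}  p n m = refl
  sumFin-cong {suc k} p n m = cong₂ _+_ (p fzero n m) (sumFin-cong (λ i → p (fsuc i)) n m)

  *ₛ-sumFin : ∀ {k} f (g : Fin k → Series) → f *ₛ sumFin g ≈ sumFin (λ i → f *ₛ g i)
  *ₛ-sumFin {zero}  f g = ≈-trans (*ₛ-congˡ f (λ n m → ℤP.+-inverseʳ (oneₛ n m)))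
                         (≈-trans (zeroʳ f) (λ n m → sym (ℤP.+-inverseʳ (oneₛ n m))))
    where open CommutativeRing seriesRing using (zeroʳ)
  *ₛ-sumFin {suc k} f g n m =
    trans (*ₛ-distribˡ f (g fzero) (sumFin (λ i → g (fsuc i))) n m)
          (cong ((f *ₛ g fzero) n m +_) (*ₛ-sumFin f (λ i → g (fsuc i)) n m))

module SeriesAlgebra where

  open import Data.Integer using (ℤ; _+_; _*_)
  import Data.Integer.Properties as ℤP
  open import Data.Maybe using (Maybe; just; nothing)
  open import Relation.Nullary using (yes; no)
  open import Relation.Binary.PropositionalEquality
  open import Algebra.Bundles using (CommutativeRing)
  open import Algebra.Solver.Ring.AlmostCommutativeRing
  open SeriesRing

  constant : ℤ → Series
  constant c n m = c * oneₛ n m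

  constant-homomorphism :
    CommutativeRing.rawRing ℤP.+-*-commutativeRing -Raw-AlmostCommutative⟶ fromCommutativeRing seriesRing
  constant-homomorphism = record
    { ⟦_⟧    = constant
    ; +-homo = λ c d n m → ℤP.*-distribʳ-+ (oneₛ n m) c d
    ; *-homo = λ c d n m → trans (ℤP.*-assoc c d (oneₛ n m))
                 (sym (trans (*ₛ-scalar c oneₛ (constant d) n m)
                             (cong (c *_) (*ₛ-identityˡ (constant d) n m))))
    ; -‿homo = λ c n m → sym (ℤP.neg-distribˡ-* c (oneₛ n m))
    ; 0-homo = λ n m → refl
    ; 1-homo = λ n m → ℤP.*-identityˡ (oneₛ n m)
    }

  constant-≟ : ∀ c d → Maybe (constant c ≈ constant d)
  constant-≟ c d with c ℤP.≟ d
  ... | yes c≡d = just (λ n m → cong (_* oneₛ n m) c≡d)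
  ... | no  _   = nothing

  open import Algebra.Solver.Ring
    (CommutativeRing.rawRing ℤP.+-*-commutativeRing) (fromCommutativeRing seriesRing)
    constant-homomorphism constant-≟
    using (solve; _:+_; _:-_; _:*_; _:^_; _:=_)
  open CommutativeRing seriesRing using (zeroˡ; zeroʳ; -‿inverseʳ; +-cong; +-congʳ)

  one-minus-* : ∀ f g → (oneₛ -ₛ f) *ₛ g ≈ g -ₛ f *ₛ g
  one-minus-* = solve 2 (λ f g → (f :^ 0 :- f) :* g := g :- f :* g) (λ n m → refl)

  difference-≈0 : ∀ {f g} → f ≈ g → f -ₛ g ≈ zeroₛ
  difference-≈0 {f} {g} f≈g = ≈-trans (+-congʳ f≈g) (-‿inverseʳ g)

  -- Indeed F · Den − Num is a combination of the three
  -- differences  F − (1 + KF + H),  (1−x)K − (xq − x²q + x³q),  H B − x²qF.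
  rationalIdentity : ∀ (F H K S : Series) →
    F ≈ oneₛ +ₛ K *ₛ F +ₛ H →
    (oneₛ -ₛ X) *ₛ K ≈ X *ₛ Q -ₛ (X ^ₛ 2) *ₛ Q +ₛ (X ^ₛ 3) *ₛ Q →
    H *ₛ (oneₛ +ₛ X *ₛ S) ≈ (X ^ₛ 2) *ₛ Q *ₛ F →
    F *ₛ ((oneₛ -ₛ X *ₛ (oneₛ +ₛ Q) +ₛ (oneₛ -ₛ X) *ₛ (X ^ₛ 2) *ₛ Q) *ₛ (oneₛ +ₛ X *ₛ S)
          -ₛ (oneₛ -ₛ X) *ₛ (X ^ₛ 2) *ₛ Q)
      ≈ (oneₛ -ₛ X) *ₛ (oneₛ +ₛ X *ₛ S)
  rationalIdentity F H K S F-equation K-equation H-equation =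
    ≈-trans (combination X Q F H K S)
            (λ n m → trans (cong (((oneₛ -ₛ X) *ₛ Bₛ) n m +_) (remainder n m)) (ℤP.+-identityʳ _))
    where
    Bₛ : Series
    Bₛ = oneₛ +ₛ X *ₛ S
    annihilateˡ : ∀ c {d} → d ≈ zeroₛ → c *ₛ d ≈ zeroₛ
    annihilateˡ c d≈0 = ≈-trans (*ₛ-congˡ c d≈0) (zeroʳ c)
    annihilateʳ : ∀ c {d} → d ≈ zeroₛ → d *ₛ c ≈ zeroₛ
    annihilateʳ c d≈0 = ≈-trans (*ₛ-congʳ c d≈0) (zeroˡ c)
    remainder :
      (oneₛ -ₛ X) *ₛ (H *ₛ Bₛ -ₛ (X ^ₛ 2) *ₛ Q *ₛ F)
      +ₛ ((oneₛ -ₛ X) *ₛ (F -ₛ (oneₛ +ₛ K *ₛ F +ₛ H))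
          +ₛ ((oneₛ -ₛ X) *ₛ K -ₛ (X *ₛ Q -ₛ (X ^ₛ 2) *ₛ Q +ₛ (X ^ₛ 3) *ₛ Q)) *ₛ F) *ₛ Bₛ
      ≈ zeroₛ
    remainder =
      +-cong (annihilateˡ (oneₛ -ₛ X) (difference-≈0 H-equation))
             (annihilateʳ Bₛ (+-cong (annihilateˡ (oneₛ -ₛ X) (difference-≈0 F-equation))
                                     (annihilateʳ F (difference-≈0 K-equation))))
    -- (the constant 1 is written x :^ 0 so that it denotes oneₛ itself)
    combination : ∀ x q f h k s →
      f *ₛ ((oneₛ -ₛ x *ₛ (oneₛ +ₛ q) +ₛ (oneₛ -ₛ x) *ₛ (x ^ₛ 2) *ₛ q) *ₛ (oneₛ +ₛ x *ₛ s)
            -ₛ (oneₛ -ₛ x) *ₛ (x ^ₛ 2) *ₛ q)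
      ≈ (oneₛ -ₛ x) *ₛ (oneₛ +ₛ x *ₛ s)
        +ₛ ((oneₛ -ₛ x) *ₛ (h *ₛ (oneₛ +ₛ x *ₛ s) -ₛ (x ^ₛ 2) *ₛ q *ₛ f)
            +ₛ ((oneₛ -ₛ x) *ₛ (f -ₛ (oneₛ +ₛ k *ₛ f +ₛ h))
                +ₛ ((oneₛ -ₛ x) *ₛ k -ₛ (x *ₛ q -ₛ (x ^ₛ 2) *ₛ q +ₛ (x ^ₛ 3) *ₛ q)) *ₛ f)
               *ₛ (oneₛ +ₛ x *ₛ s))
    combination = solve 6 (λ x q f h k s →
       f :* ((x :^ 0 :- x :* (x :^ 0 :+ q) :+ (x :^ 0 :- x) :* (x :^ 2) :* q) :* (x :^ 0 :+ x :* s)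
              :- (x :^ 0 :- x) :* (x :^ 2) :* q)
       := (x :^ 0 :- x) :* (x :^ 0 :+ x :* s)
          :+ ((x :^ 0 :- x) :* (h :* (x :^ 0 :+ x :* s) :- (x :^ 2) :* q :* f)
              :+ ((x :^ 0 :- x) :* (f :- (x :^ 0 :+ k :* f :+ h))
                  :+ ((x :^ 0 :- x) :* k :- (x :* q :- (x :^ 2) :* q :+ (x :^ 3) :* q)) :* f)
                 :* (x :^ 0 :+ x :* s)))
       (λ n m → refl)

module CompositionSums where

  open import Data.Nat as ℕ using (zero; s≤s; _∸_)
  import Data.Nat.Properties as ℕP
  open import Data.Integer using (ℤ; 0ℤ; 1ℤ; _+_; _*_) renaming (+_ to pos)
  import Data.Integer.Properties as ℤP
  open import Data.List using (List; []; _∷_; _++_; map; filter; length; upTo; concatMap)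
  import Data.List.Properties as ListP
  open import Data.Nat.ListAction using (sum)
  open import Data.Bool using (true; false)
  open import Data.Fin using (Fin) renaming (zero to fzero; suc to fsuc)
  open import Function using (_∘_)
  open import Function.Bundles using (mk⇔)
  open import Relation.Binary.PropositionalEquality
  open import Relation.Nullary using (Dec; does; ¬_)
  open import Relation.Nullary.Decidable using (dec-true; dec-false; does-⇔)
  open FiniteSums
  open SeriesRing using (_≈_; mono-shift)

  𝟙 : ∀ {p} {P : Set p} → Dec P → ℤ
  𝟙 d = 𝟙ᵇ (does d)

  𝟙-yes : ∀ {p} {P : Set p} → P → (d : Dec P) → 𝟙 d ≡ 1ℤ
  𝟙-yes p d = cong 𝟙ᵇ (dec-true d p)

  𝟙-no : ∀ {p} {P : Set p} → ¬ P → (d : Dec P) → 𝟙 d ≡ 0ℤ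
  𝟙-no ¬p d = cong 𝟙ᵇ (dec-false d ¬p)

  𝟙-⇔ : ∀ {p q} {P : Set p} {Q : Set q} → (P → Q) → (Q → P) → (d : Dec P) (e : Dec Q) → 𝟙 d ≡ 𝟙 e
  𝟙-⇔ f g d e = cong 𝟙ᵇ (does-⇔ (mk⇔ f g) d e)

  ∑comp : ℕ → ℕ → (List ℕ → ℤ) → ℤ
  ∑comp zero    zero    φ = φ []
  ∑comp zero    (suc n) φ = 0ℤ
  ∑comp (suc m) n       φ = ∑ n (λ i → ∑comp m (n ∸ suc i) (λ σ → φ (suc i ∷ σ)))

  gen : (List ℕ → ℤ) → Series
  gen φ n m = ∑comp m n φ

  ∑comp-cong : ∀ m n {φ ψ : List ℕ → ℤ} → (∀ σ → φ σ ≡ ψ σ) → ∑comp m n φ ≡ ∑comp m n ψ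
  ∑comp-cong zero    zero    h = h []
  ∑comp-cong zero    (suc n) h = refl
  ∑comp-cong (suc m) n       h = ∑-cong′ n (λ i → ∑comp-cong m (n ∸ suc i) (λ σ → h (suc i ∷ σ)))

  ∑comp-+ : ∀ m n (φ ψ : List ℕ → ℤ) → ∑comp m n (λ σ → φ σ + ψ σ) ≡ ∑comp m n φ + ∑comp m n ψ
  ∑comp-+ zero    zero    φ ψ = refl
  ∑comp-+ zero    (suc n) φ ψ = refl
  ∑comp-+ (suc m) n       φ ψ =
    trans (∑-cong′ n (λ i → ∑comp-+ m (n ∸ suc i) (λ σ → φ (suc i ∷ σ)) (λ σ → ψ (suc i ∷ σ))))
          (∑-+ (λ i → ∑comp m (n ∸ suc i) (λ σ → φ (suc i ∷ σ)))
               (λ i → ∑comp m (n ∸ suc i) (λ σ → ψ (suc i ∷ σ))) n)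

  ∑comp-zero : ∀ m n {φ : List ℕ → ℤ} → (∀ σ → φ σ ≡ 0ℤ) → ∑comp m n φ ≡ 0ℤ
  ∑comp-zero zero    zero    h = h []
  ∑comp-zero zero    (suc n) h = refl
  ∑comp-zero (suc m) n       h = ∑-zero n (λ i _ → ∑comp-zero m (n ∸ suc i) (λ σ → h (suc i ∷ σ)))

  ∑comp-*ˡ : ∀ m n c (φ : List ℕ → ℤ) → ∑comp m n (λ σ → c * φ σ) ≡ c * ∑comp m n φ
  ∑comp-*ˡ zero    zero    c φ = refl
  ∑comp-*ˡ zero    (suc n) c φ = sym (ℤP.*-zeroʳ c)
  ∑comp-*ˡ (suc m) n       c φ =
    trans (∑-cong′ n (λ i → ∑comp-*ˡ m (n ∸ suc i) c (λ σ → φ (suc i ∷ σ))))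
          (sym (∑-*ˡ c (λ i → ∑comp m (n ∸ suc i) (λ σ → φ (suc i ∷ σ))) n))

  ∑comp-∑Fin : ∀ {k} m n (φ : Fin k → List ℕ → ℤ) →
    ∑comp m n (λ σ → ∑Fin (λ i → φ i σ)) ≡ ∑Fin (λ i → ∑comp m n (φ i))
  ∑comp-∑Fin {zero}  m n φ = ∑comp-zero m n (λ _ → refl)
  ∑comp-∑Fin {suc k} m n φ =
    trans (∑comp-+ m n (φ fzero) (λ σ → ∑Fin (λ i → φ (fsuc i) σ)))
          (cong (∑comp m n (φ fzero) +_) (∑comp-∑Fin m n (λ i → φ (fsuc i))))

  gen-prepend : ∀ p (φ : List ℕ → ℤ) → φ [] ≡ 0ℤ → (∀ x σ → x ≢ suc p → φ (x ∷ σ) ≡ 0ℤ) →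
                gen φ ≈ mono (suc p) 1 *ₛ gen (λ σ → φ (suc p ∷ σ))
  gen-prepend p φ φ[] φ∷ n m =
    sym (trans (mono-shift (suc p) 1 (gen (λ σ → φ (suc p ∷ σ))) n m) (shifted n m))
    where
    shifted : ∀ n m → restrict (suc p) (suc n) (restrict 1 (suc m) (∑comp (m ∸ 1) (n ∸ suc p) (λ σ → φ (suc p ∷ σ))))
                      ≡ ∑comp m n φ
    shifted zero    zero    = sym φ[]
    shifted (suc n) zero    = restrict-0 p (suc n)
    shifted n       (suc m) = sym (∑-single p n (λ i → ∑comp m (n ∸ suc i) (λ σ → φ (suc i ∷ σ)))
      (λ i i≢p → ∑comp-zero m (n ∸ suc i) (λ σ → φ∷ (suc i) σ (i≢p ∘ cong ℕ.pred))))

  sumℤ-++ : ∀ xs ys → sumℤ (xs ++ ys) ≡ sumℤ xs + sumℤ ys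
  sumℤ-++ []       ys = sym (ℤP.+-identityˡ _)
  sumℤ-++ (x ∷ xs) ys = trans (cong (x +_) (sumℤ-++ xs ys)) (sym (ℤP.+-assoc x _ _))

  sumℤ-concatMap : ∀ {A B : Set} (φ : B → ℤ) (g : A → List B) (xs : List A) →
    sumℤ (map φ (concatMap g xs)) ≡ sumℤ (map (λ x → sumℤ (map φ (g x))) xs)
  sumℤ-concatMap φ g []       = refl
  sumℤ-concatMap φ g (x ∷ xs) =
    trans (cong sumℤ (ListP.map-++ φ (g x) (concatMap g xs)))
    (trans (sumℤ-++ (map φ (g x)) (map φ (concatMap g xs)))
           (cong (sumℤ (map φ (g x)) +_) (sumℤ-concatMap φ g xs)))

  sumℤ-cong : ∀ {A : Set} {φ ψ : A → ℤ} (xs : List A) → (∀ x → φ x ≡ ψ x) →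
              sumℤ (map φ xs) ≡ sumℤ (map ψ xs)
  sumℤ-cong xs h = cong sumℤ (ListP.map-cong h xs)

  sumℤ-zero : ∀ {A : Set} {φ : A → ℤ} (xs : List A) → (∀ x → φ x ≡ 0ℤ) → sumℤ (map φ xs) ≡ 0ℤ
  sumℤ-zero []       h = refl
  sumℤ-zero (x ∷ xs) h = cong₂ _+_ (h x) (sumℤ-zero xs h)

  sumℤ-filter : ∀ {A : Set} {P : A → Set} (P? : ∀ x → Dec (P x)) (φ : A → ℤ) (xs : List A) →
    sumℤ (map φ (filter P? xs)) ≡ sumℤ (map (λ x → 𝟙 (P? x) * φ x) xs)
  sumℤ-filter P? φ []       = refl
  sumℤ-filter P? φ (x ∷ xs) with does (P? x)
  ... | true  = cong₂ _+_ (sym (ℤP.*-identityˡ (φ x))) (sumℤ-filter P? φ xs)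
  ... | false = trans (sumℤ-filter P? φ xs) (sym (ℤP.+-identityˡ _))

  length-sumℤ : ∀ {A : Set} (xs : List A) → pos (length xs) ≡ sumℤ (map (λ _ → 1ℤ) xs)
  length-sumℤ []       = refl
  length-sumℤ (x ∷ xs) = trans (ℤP.pos-+ 1 (length xs)) (cong (1ℤ +_) (length-sumℤ xs))

  ∑words : ℕ → ℕ → (List ℕ → ℤ) → ℤ
  ∑words m N φ = sumℤ (map φ (words m (map suc (upTo N))))

  ∑words-suc : ∀ m N φ → ∑words (suc m) N φ ≡ ∑ N (λ i → ∑words m N (λ σ → φ (suc i ∷ σ)))
  ∑words-suc m N φ =
    trans (sumℤ-concatMap φ (λ x → map (x ∷_) ws) (map suc (upTo N)))
    (trans (sumℤ-cong (map suc (upTo N)) (λ x → cong sumℤ (sym (ListP.map-∘ ws))))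
    (trans (cong sumℤ (sym (ListP.map-∘ (upTo N))))
           (sumℤ-upTo (λ i → ∑words m N (λ σ → φ (suc i ∷ σ))) N)))
    where ws = words m (map suc (upTo N))

  -- Words of weight n with letters ≤ N (where n ≤ N) are exactly the
  -- compositions of n, so restricting the word sum to weight n gives ∑comp.
  ∑words-weight : ∀ m n N → n ℕ.≤ N → ∀ (φ : List ℕ → ℤ) →
    ∑words m N (λ σ → 𝟙 (sum σ ℕ.≟ n) * φ σ) ≡ ∑comp m n φ
  ∑words-weight zero zero    N n≤N φ = trans (ℤP.+-identityʳ _) (ℤP.*-identityˡ (φ []))
  ∑words-weight zero (suc n) N n≤N φ = refl
  ∑words-weight (suc m) n N n≤N φ =
    trans (∑words-suc m N (λ σ → 𝟙 (sum σ ℕ.≟ n) * φ σ))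
    (trans (∑-truncate _ n N n≤N tooHeavy)
           (∑-cong n (λ i i<n → trans (∑words-cong i i<n)
              (∑words-weight m (n ∸ suc i) N (ℕP.≤-trans (ℕP.m∸n≤m n (suc i)) n≤N)
                             (λ σ → φ (suc i ∷ σ))))))
    where
    tooHeavy : ∀ i → n ℕ.≤ i → ∑words m N (λ σ → 𝟙 (sum (suc i ∷ σ) ℕ.≟ n) * φ (suc i ∷ σ)) ≡ 0ℤ
    tooHeavy i n≤i = sumℤ-zero (words m (map suc (upTo N))) (λ σ →
      cong (_* φ (suc i ∷ σ)) (𝟙-no (λ e → ℕP.<⇒≢ (s≤s (ℕP.≤-trans n≤i (ℕP.m≤m+n i (sum σ)))) (sym e))
                                    (sum (suc i ∷ σ) ℕ.≟ n)))
    ∑words-cong : ∀ i → i ℕ.< n →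
      ∑words m N (λ σ → 𝟙 (sum (suc i ∷ σ) ℕ.≟ n) * φ (suc i ∷ σ)) ≡
      ∑words m N (λ σ → 𝟙 (sum σ ℕ.≟ n ∸ suc i) * φ (suc i ∷ σ))
    ∑words-cong i i<n = sumℤ-cong (words m (map suc (upTo N))) (λ σ → cong (_* φ (suc i ∷ σ))
      (𝟙-⇔ (λ e → trans (sym (ℕP.m+n∸m≡n (suc i) (sum σ))) (cong (_∸ suc i) e))
           (λ e → trans (cong (suc i ℕ.+_) e) (ℕP.m+[n∸m]≡n i<n))
           (sum (suc i ∷ σ) ℕ.≟ n) (sum σ ℕ.≟ n ∸ suc i)))

  count-≡-∑comp : ∀ {P : List ℕ → Set} (P? : ∀ σ → Dec (P σ)) n m →
    pos (length (filter P? (compositions n m))) ≡ ∑comp m n (λ σ → 𝟙 (P? σ))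
  count-≡-∑comp P? n m = begin
    pos (length (filter P? (compositions n m)))
      ≡⟨ length-sumℤ (filter P? (compositions n m)) ⟩
    sumℤ (map (λ _ → 1ℤ) (filter P? (compositions n m)))
      ≡⟨ sumℤ-filter P? (λ _ → 1ℤ) (compositions n m) ⟩
    sumℤ (map (λ σ → 𝟙 (P? σ) * 1ℤ) (compositions n m))
      ≡⟨ sumℤ-filter (λ σ → sum σ ℕ.≟ n) (λ σ → 𝟙 (P? σ) * 1ℤ) (words m (map suc (upTo n))) ⟩
    ∑words m n (λ σ → 𝟙 (sum σ ℕ.≟ n) * (𝟙 (P? σ) * 1ℤ))
      ≡⟨ sumℤ-cong (words m (map suc (upTo n)))
           (λ σ → cong (𝟙 (sum σ ℕ.≟ n) *_) (ℤP.*-identityʳ (𝟙 (P? σ)))) ⟩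
    ∑words m n (λ σ → 𝟙 (sum σ ℕ.≟ n) * 𝟙 (P? σ))
      ≡⟨ ∑words-weight m n n ℕP.≤-refl (λ σ → 𝟙 (P? σ)) ⟩
    ∑comp m n (λ σ → 𝟙 (P? σ)) ∎
    where open ≡-Reasoning

module Avoidance where

  open import Data.Nat as ℕ using (zero; _∸_)
  open import Data.Integer using (ℤ; 1ℤ; _+_; _*_)
  import Data.Integer.Properties as ℤP
  open import Data.List using (List; []; _∷_; _++_; [_]; replicate)
  open import Data.Bool using (Bool; true; false) renaming (_≟_ to _≟ᵇ_)
  open import Data.Bool.Properties using (¬-not)
  open import Data.Fin using (Fin) renaming (zero to fzero; suc to fsuc)
  import Data.Fin.Properties as FinP
  open import Data.Product using (_,_)
  open import Data.Sum using (_⊎_; inj₁; inj₂)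
  open import Data.Empty using (⊥-elim)
  open import Relation.Binary.PropositionalEquality hiding ([_])
  open import Relation.Nullary using (¬_; yes; no)
  open import Data.List.Relation.Unary.All using ([]; _∷_)
  open import Data.List.Relation.Binary.Infix.Heterogeneous using (here; there)
  open import Data.List.Relation.Binary.Prefix.Heterogeneous using (Prefix; []; _∷_)
  open FiniteSums
  open CompositionSums

  avoids⇒ : ∀ {k} (a : Fin k → ℕ) {σ} → Avoids a σ → ∀ i → ¬ Contains σ (S (a i))
  avoids⇒ a (¬c ∷ _)   fzero    = ¬c
  avoids⇒ a (_  ∷ ¬cs) (fsuc i) = avoids⇒ (λ j → a (fsuc j)) ¬cs i

  ⇒avoids : ∀ {k} (a : Fin k → ℕ) {σ} → (∀ i → ¬ Contains σ (S (a i))) → Avoids a σ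
  ⇒avoids {zero}  a h = []
  ⇒avoids {suc k} a h = h fzero ∷ ⇒avoids (λ j → a (fsuc j)) (λ i → h (fsuc i))

  startsWith : ℕ → List ℕ → Bool
  startsWith zero    (2 ∷ w) = true
  startsWith (suc r) (1 ∷ w) = startsWith r w
  startsWith _       _       = false

  block : ℕ → List ℕ
  block r = replicate r 1 ++ [ 2 ]

  startsWith-sound : ∀ r w → startsWith r w ≡ true → Prefix _≡_ (block r) w
  startsWith-sound zero    (2 ∷ w) _ = refl ∷ []
  startsWith-sound (suc r) (1 ∷ w) e = refl ∷ startsWith-sound r w e
  startsWith-sound zero    []                        ()
  startsWith-sound zero    (0 ∷ w)                   ()
  startsWith-sound zero    (1 ∷ w)                   ()
  startsWith-sound zero    (suc (suc (suc x)) ∷ w)   ()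
  startsWith-sound (suc r) []                        ()
  startsWith-sound (suc r) (0 ∷ w)                   ()
  startsWith-sound (suc r) (suc (suc x) ∷ w)         ()

  startsWith-complete : ∀ r w → Prefix _≡_ (block r) w → startsWith r w ≡ true
  startsWith-complete zero    (x ∷ w) (refl ∷ []) = refl
  startsWith-complete (suc r) (x ∷ w) (refl ∷ p)  = startsWith-complete r w p

  block-unique : ∀ r r′ w → Prefix _≡_ (block r) w → Prefix _≡_ (block r′) w → r ≡ r′
  block-unique zero    zero     w       _          _          = refl
  block-unique zero    (suc r′) (x ∷ w) (refl ∷ _) (() ∷ _)
  block-unique (suc r) zero     (x ∷ w) (refl ∷ _) (() ∷ _)
  block-unique (suc r) (suc r′) (x ∷ w) (_ ∷ p)    (_ ∷ p′)   = cong suc (block-unique r r′ w p p′)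

  startsWith-unique : ∀ r r′ w → startsWith r w ≡ true → startsWith r′ w ≡ true → r ≡ r′
  startsWith-unique r r′ w p p′ = block-unique r r′ w (startsWith-sound r w p) (startsWith-sound r′ w p′)

  startsWith-0-∷ : ∀ x w → x ≢ 2 → startsWith 0 (x ∷ w) ≡ false
  startsWith-0-∷ 0                   w _   = refl
  startsWith-0-∷ 1                   w _   = refl
  startsWith-0-∷ 2                   w x≢2 = ⊥-elim (x≢2 refl)
  startsWith-0-∷ (suc (suc (suc x))) w _   = refl

  startsWith-suc-∷ : ∀ r x w → x ≢ 1 → startsWith (suc r) (x ∷ w) ≡ false
  startsWith-suc-∷ r 0             w _   = refl
  startsWith-suc-∷ r 1             w x≢1 = ⊥-elim (x≢1 refl)
  startsWith-suc-∷ r (suc (suc x)) w _   = refl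

  contains-2∷ : ∀ a w → Contains (2 ∷ w) (S a) → startsWith (a ∸ 1) w ≡ true ⊎ Contains w (S a)
  contains-2∷ a w (here (refl ∷ p)) = inj₁ (startsWith-complete (a ∸ 1) w p)
  contains-2∷ a w (there c)         = inj₂ c

  module Avoiding {k} (a : Fin k → ℕ) where

    av : List ℕ → ℤ
    av σ = 𝟙 (avoids? a σ)

    av-[] : av [] ≡ 1ℤ
    av-[] = 𝟙-yes (⇒avoids a (λ i → λ { (here ()) })) (avoids? a [])

    -- A first part other than 2 cannot start an occurrence of any S_{a_i}.
    av-∷ : ∀ x w → ¬ (2 ≡ x) → av (x ∷ w) ≡ av w
    av-∷ x w 2≢x = 𝟙-⇔
      (λ A → ⇒avoids a (λ i c → avoids⇒ a A i (there c)))
      (λ A → ⇒avoids a (λ i → λ { (here (2≡x ∷ _)) → 2≢x 2≡x ; (there c) → avoids⇒ a A i c }))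
      (avoids? a (x ∷ w)) (avoids? a w)

    -- The a_i must be distinct and positive, so that at most one block fits.
    av-prepend-2 : (∀ i → 1 ℕ.≤ a i) → (∀ i j → a i ≡ a j → i ≡ j) →
      ∀ w → av w ≡ av (2 ∷ w) + ∑Fin (λ i → 𝟙ᵇ (startsWith (a i ∸ 1) w) * av w)
    av-prepend-2 positive injective w with avoids? a w
    ... | no ¬A = sym (cong₂ _+_
            (𝟙-no (λ A₂ → ¬A (⇒avoids a (λ i c → avoids⇒ a A₂ i (there c)))) (avoids? a (2 ∷ w)))
            (∑Fin-zero _ (λ i → ℤP.*-zeroʳ (𝟙ᵇ (startsWith (a i ∸ 1) w)))))
    ... | yes A with FinP.any? (λ i → startsWith (a i ∸ 1) w ≟ᵇ true)
    ...   | yes (i , bᵢ) = sym (cong₂ _+_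
             (𝟙-no (λ A₂ → avoids⇒ a A₂ i (here (refl ∷ startsWith-sound (a i ∸ 1) w bᵢ))) (avoids? a (2 ∷ w)))
             (trans (∑Fin-cong (λ j → ℤP.*-identityʳ (𝟙ᵇ (startsWith (a j ∸ 1) w))))
                    (∑Fin-unique (λ j → startsWith (a j ∸ 1) w) blockIndexUnique i bᵢ)))
      where
      pred-injective : ∀ {x y} → 1 ℕ.≤ x → 1 ℕ.≤ y → x ∸ 1 ≡ y ∸ 1 → x ≡ y
      pred-injective (ℕ.s≤s ℕ.z≤n) (ℕ.s≤s ℕ.z≤n) e = cong suc e
      blockIndexUnique : ∀ j j′ → startsWith (a j ∸ 1) w ≡ true → startsWith (a j′ ∸ 1) w ≡ true → j ≡ j′
      blockIndexUnique j j′ p q =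
        injective j j′ (pred-injective (positive j) (positive j′) (startsWith-unique _ _ w p q))
    ...   | no none = sym (cong₂ _+_
             (𝟙-yes (⇒avoids a noOccurrence) (avoids? a (2 ∷ w)))
             (∑Fin-zero _ (λ i → cong (λ b → 𝟙ᵇ b * 1ℤ) (¬-not (λ bᵢ → none (i , bᵢ))))))
      where
      noOccurrence : ∀ i → ¬ Contains (2 ∷ w) (S (a i))
      noOccurrence i c with contains-2∷ (a i) w c
      ... | inj₁ bᵢ = none (i , bᵢ)
      ... | inj₂ c′ = avoids⇒ a A i c′

module SinglePart where

  open import Data.Nat as ℕ using (zero; _∸_)
  open import Data.Integer using (ℤ; 0ℤ; 1ℤ; _+_; _-_; _*_)
  import Data.Integer.Properties as ℤP
  open import Relation.Binary.PropositionalEquality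
  open FiniteSums
  open SeriesRing
  open SeriesAlgebra using (one-minus-*)

  notTwo : ℕ → ℤ
  notTwo 0                 = 0ℤ
  notTwo 1                 = 1ℤ
  notTwo 2                 = 0ℤ
  notTwo (suc (suc (suc p))) = 1ℤ

  K : Series
  K n 1 = notTwo n
  K n _ = 0ℤ

  K*-coeff-0 : ∀ f n → (K *ₛ f) n 0 ≡ 0ℤ
  K*-coeff-0 f n = trans (*ₛ-coeff K f n 0)
    (∑-zero (suc n) (λ i _ → trans (ℤP.+-identityʳ (0ℤ * f (n ∸ i) 0)) (ℤP.*-zeroˡ (f (n ∸ i) 0))))

  K*-coeff : ∀ f n M → (K *ₛ f) n (suc M) ≡ ∑ n (λ i → notTwo (suc i) * f (n ∸ suc i) M)
  K*-coeff f n M = begin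
    (K *ₛ f) n (suc M)
      ≡⟨ *ₛ-coeff K f n (suc M) ⟩
    ∑ (suc n) (λ i → 0ℤ * f (n ∸ i) (suc M)
                     + (notTwo i * f (n ∸ i) M + ∑ M (λ j → 0ℤ * f (n ∸ i) (M ∸ j))))
      ≡⟨ ∑-cong′ (suc n) (λ i → onlyLengthOne (f (n ∸ i) (suc M)) (notTwo i * f (n ∸ i) M)
                                   (∑-zero M (λ j _ → ℤP.*-zeroˡ (f (n ∸ i) (M ∸ j))))) ⟩
    ∑ (suc n) (λ i → notTwo i * f (n ∸ i) M)
      ≡⟨ ℤP.+-identityˡ _ ⟩
    ∑ n (λ i → notTwo (suc i) * f (n ∸ suc i) M) ∎
    where
    open ≡-Reasoning
    onlyLengthOne : ∀ x y {z} → z ≡ 0ℤ → 0ℤ * x + (y + z) ≡ y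
    onlyLengthOne x y refl = trans (ℤP.+-identityˡ (y + 0ℤ)) (ℤP.+-identityʳ y)

  K-equation : (oneₛ -ₛ X) *ₛ K ≈ X *ₛ Q -ₛ (X ^ₛ 2) *ₛ Q +ₛ (X ^ₛ 3) *ₛ Q
  K-equation n m = begin
    ((oneₛ -ₛ X) *ₛ K) n m
      ≡⟨ one-minus-* X K n m ⟩
    K n m - (X *ₛ K) n m
      ≡⟨ cong (K n m -_) (mono-shift 1 0 K n m) ⟩
    K n m - restrict 1 (suc n) (K (n ∸ 1) m)
      ≡⟨ coefficients n m ⟩
    mono 1 1 n m - mono 2 1 n m + mono 3 1 n m
      ≡⟨ sym (cong₂ _+_ (cong₂ _-_ (mono-* 1 0 0 1 n m) (X^Q 2 n m)) (X^Q 3 n m)) ⟩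
    (X *ₛ Q -ₛ (X ^ₛ 2) *ₛ Q +ₛ (X ^ₛ 3) *ₛ Q) n m ∎
    where
    open ≡-Reasoning
    coefficients : ∀ n m → K n m - restrict 1 (suc n) (K (n ∸ 1) m) ≡ mono 1 1 n m - mono 2 1 n m + mono 3 1 n m
    coefficients 0                       0             = refl
    coefficients 0                       1             = refl
    coefficients 0                       (suc (suc m)) = refl
    coefficients 1                       0             = refl
    coefficients 1                       1             = refl
    coefficients 1                       (suc (suc m)) = refl
    coefficients 2                       0             = refl
    coefficients 2                       1             = refl
    coefficients 2                       (suc (suc m)) = refl
    coefficients 3                       0             = refl
    coefficients 3                       1             = refl
    coefficients 3                       (suc (suc m)) = refl
    coefficients (suc (suc (suc (suc n)))) 0             = refl
    coefficients (suc (suc (suc (suc n)))) 1             = refl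
    coefficients (suc (suc (suc (suc n)))) (suc (suc m)) = refl

module FunctionalEquations {k} (a : Fin k → ℕ) where

  open import Data.Nat as ℕ using (zero; _∸_)
  open import Data.Integer using (ℤ; 0ℤ; 1ℤ; _+_; _*_)
  import Data.Integer.Properties as ℤP
  open import Data.List using (List; []; _∷_)
  open import Relation.Binary.PropositionalEquality using (_≡_; sym; trans; cong; module ≡-Reasoning)
  open import Algebra.Bundles using (CommutativeRing)
  open FiniteSums
  open SeriesRing
  open CompositionSums
  open Avoidance
  open Avoiding a
  open SinglePart

  F H : Series
  F = gen av
  H = gen (λ w → 𝟙ᵇ (startsWith 0 w) * av w)

  Block : ℕ → Series
  Block r = gen (λ w → 𝟙ᵇ (startsWith r w) * av w)

  V≈F : V a ≈ F
  V≈F n m = count-≡-∑comp (avoids? a) n m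

  av-firstPart : ∀ p w → av (suc p ∷ w) ≡ notTwo (suc p) * av w + 𝟙ᵇ (startsWith 0 (suc p ∷ w)) * av (suc p ∷ w)
  av-firstPart 0             w = sym (trans (ℤP.+-identityʳ (1ℤ * av w))
                                   (trans (ℤP.*-identityˡ (av w)) (sym (av-∷ 1 w (λ ())))))
  av-firstPart 1             w = sym (trans (ℤP.+-identityˡ (1ℤ * av (2 ∷ w))) (ℤP.*-identityˡ (av (2 ∷ w))))
  av-firstPart (suc (suc p)) w = sym (trans (ℤP.+-identityʳ (1ℤ * av w))
                                   (trans (ℤP.*-identityˡ (av w)) (sym (av-∷ (suc (suc (suc p))) w (λ ())))))

  F-equation : F ≈ oneₛ +ₛ K *ₛ F +ₛ H
  F-equation zero    zero = sym (trans (cong (λ z → 1ℤ + z + 0ℤ) (K*-coeff-0 F 0)) (sym av-[]))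
  F-equation (suc n) zero = sym (cong (λ z → 0ℤ + z + 0ℤ) (K*-coeff-0 F (suc n)))
  F-equation n (suc M) = begin
    ∑ n (λ i → ∑comp M (n ∸ suc i) (λ w → av (suc i ∷ w)))
      ≡⟨ ∑-cong′ n (λ i → trans (∑comp-cong M (n ∸ suc i) (av-firstPart i))
                                 (∑comp-+ M (n ∸ suc i) (λ w → notTwo (suc i) * av w) (H-term i))) ⟩
    ∑ n (λ i → ∑comp M (n ∸ suc i) (λ w → notTwo (suc i) * av w) + ∑comp M (n ∸ suc i) (H-term i))
      ≡⟨ ∑-+ (λ i → ∑comp M (n ∸ suc i) (λ w → notTwo (suc i) * av w))
             (λ i → ∑comp M (n ∸ suc i) (H-term i)) n ⟩
    ∑ n (λ i → ∑comp M (n ∸ suc i) (λ w → notTwo (suc i) * av w)) + H n (suc M)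
      ≡⟨ cong (_+ H n (suc M)) (trans (∑-cong′ n (λ i → ∑comp-*ˡ M (n ∸ suc i) (notTwo (suc i)) av))
                                      (sym (K*-coeff F n M))) ⟩
    (K *ₛ F) n (suc M) + H n (suc M)
      ≡⟨ cong (_+ H n (suc M)) (sym (ℤP.+-identityˡ ((K *ₛ F) n (suc M)))) ⟩
    0ℤ + (K *ₛ F) n (suc M) + H n (suc M)
      ≡⟨ cong (λ z → z + (K *ₛ F) n (suc M) + H n (suc M))
              (sym (trans (mono-δ 0 0 n (suc M)) (ℤP.*-zeroʳ (δ 0 n)))) ⟩
    (oneₛ +ₛ K *ₛ F +ₛ H) n (suc M) ∎
    where
    open ≡-Reasoning
    H-term : ℕ → List ℕ → ℤ
    H-term i w = 𝟙ᵇ (startsWith 0 (suc i ∷ w)) * av (suc i ∷ w)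

  -- Removing the block 1^r from words beginning with 1^r 2 (prepending 1
  -- does not affect avoidance).
  Block-shift : ∀ r → Block r ≈ mono r r *ₛ H
  Block-shift zero    = ≈-sym (*ₛ-identityˡ H)
  Block-shift (suc r) =
    ≈-trans (gen-prepend 0 (λ w → 𝟙ᵇ (startsWith (suc r) w) * av w) (ℤP.*-zeroˡ (av []))
               (λ x w x≢1 → trans (cong (λ b → 𝟙ᵇ b * av (x ∷ w)) (startsWith-suc-∷ r x w x≢1))
                                  (ℤP.*-zeroˡ (av (x ∷ w)))))
    (≈-trans (*ₛ-congˡ (mono 1 1) (λ n m → ∑comp-cong m n (λ w →
                cong (𝟙ᵇ (startsWith r w) *_) (av-∷ 1 w (λ ())))))
    (≈-trans (*ₛ-congˡ (mono 1 1) (Block-shift r))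
    (≈-trans (≈-sym (*ₛ-assoc (mono 1 1) (mono r r) H))
             (*ₛ-congʳ H (mono-* 1 1 r r)))))

  H-shift : H ≈ mono 2 1 *ₛ gen (λ w → av (2 ∷ w))
  H-shift =
    ≈-trans (gen-prepend 1 (λ w → 𝟙ᵇ (startsWith 0 w) * av w) (ℤP.*-zeroˡ (av []))
               (λ x w x≢2 → trans (cong (λ b → 𝟙ᵇ b * av (x ∷ w)) (startsWith-0-∷ x w x≢2))
                                  (ℤP.*-zeroˡ (av (x ∷ w)))))
            (*ₛ-congˡ (mono 2 1) (λ n m → ∑comp-cong m n (λ w → ℤP.*-identityˡ (av (2 ∷ w)))))

  F-prepend-2 : (∀ i → 1 ≤ a i) → (∀ i j → a i ≡ a j → i ≡ j) →
                F ≈ gen (λ w → av (2 ∷ w)) +ₛ sumFin (λ i → Block (a i ∸ 1))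
  F-prepend-2 positive injective n m = begin
    ∑comp m n av
      ≡⟨ ∑comp-cong m n (av-prepend-2 positive injective) ⟩
    ∑comp m n (λ w → av (2 ∷ w) + ∑Fin (λ i → blockTerm i w))
      ≡⟨ ∑comp-+ m n (λ w → av (2 ∷ w)) (λ w → ∑Fin (λ i → blockTerm i w)) ⟩
    ∑comp m n (λ w → av (2 ∷ w)) + ∑comp m n (λ w → ∑Fin (λ i → blockTerm i w))
      ≡⟨ cong (∑comp m n (λ w → av (2 ∷ w)) +_)
              (trans (∑comp-∑Fin m n blockTerm) (sym (sumFin-coeff (λ i → Block (a i ∸ 1)) n m))) ⟩
    (gen (λ w → av (2 ∷ w)) +ₛ sumFin (λ i → Block (a i ∸ 1))) n m ∎
    where
    open ≡-Reasoning
    blockTerm : Fin k → List ℕ → ℤ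
    blockTerm i w = 𝟙ᵇ (startsWith (a i ∸ 1) w) * av w

  xqPowers : Series
  xqPowers = sumFin (λ i → (X *ₛ Q) ^ₛ a i)

  blockTerm-shift : ∀ i → 1 ≤ a i → (X *ₛ (X *ₛ Q) ^ₛ a i) *ₛ H ≈ mono 2 1 *ₛ Block (a i ∸ 1)
  blockTerm-shift i 1≤aᵢ =
    ≈-trans (*ₛ-congʳ H (≈-trans (*ₛ-congˡ X (XQ^ (a i))) (mono-* 1 0 (a i) (a i))))
            (reindex (a i) 1≤aᵢ)
    where
    reindex : ∀ b → 1 ≤ b → mono (suc b) b *ₛ H ≈ mono 2 1 *ₛ Block (b ∸ 1)
    reindex (suc r) _ =
      ≈-trans (*ₛ-congʳ H (≈-sym (mono-* 2 1 r r)))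
      (≈-trans (*ₛ-assoc (mono 2 1) (mono r r) H)
               (*ₛ-congˡ (mono 2 1) (≈-sym (Block-shift r))))

  H-equation : (∀ i → 1 ≤ a i) → (∀ i j → a i ≡ a j → i ≡ j) →
               H *ₛ (oneₛ +ₛ X *ₛ xqPowers) ≈ (X ^ₛ 2) *ₛ Q *ₛ F
  H-equation positive injective = begin
    H *ₛ (oneₛ +ₛ X *ₛ xqPowers)
      ≈⟨ *ₛ-distribˡ H oneₛ (X *ₛ xqPowers) ⟩
    H *ₛ oneₛ +ₛ H *ₛ (X *ₛ xqPowers)
      ≈⟨ +-cong (*-identityʳ H) (≈-trans (*ₛ-comm H (X *ₛ xqPowers)) blockTerms) ⟩
    H +ₛ sumFin (λ i → mono 2 1 *ₛ Block (a i ∸ 1))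
      ≈⟨ +-cong H-shift (≈-sym (*ₛ-sumFin (mono 2 1) (λ i → Block (a i ∸ 1)))) ⟩
    mono 2 1 *ₛ gen (λ w → av (2 ∷ w)) +ₛ mono 2 1 *ₛ sumFin (λ i → Block (a i ∸ 1))
      ≈⟨ ≈-sym (*ₛ-distribˡ (mono 2 1) (gen (λ w → av (2 ∷ w))) (sumFin (λ i → Block (a i ∸ 1)))) ⟩
    mono 2 1 *ₛ (gen (λ w → av (2 ∷ w)) +ₛ sumFin (λ i → Block (a i ∸ 1)))
      ≈⟨ *ₛ-congˡ (mono 2 1) (≈-sym (F-prepend-2 positive injective)) ⟩
    mono 2 1 *ₛ F
      ≈⟨ *ₛ-congʳ F (≈-sym (X^Q 2)) ⟩
    (X ^ₛ 2) *ₛ Q *ₛ F ∎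
    where
    open CommutativeRing seriesRing using (+-cong; *-identityʳ)
    open import Relation.Binary.Reasoning.Setoid (CommutativeRing.setoid seriesRing)
    blockTerms : (X *ₛ xqPowers) *ₛ H ≈ sumFin (λ i → mono 2 1 *ₛ Block (a i ∸ 1))
    blockTerms = begin
      (X *ₛ xqPowers) *ₛ H
        ≈⟨ *ₛ-congʳ H (*ₛ-sumFin X (λ i → (X *ₛ Q) ^ₛ a i)) ⟩
      sumFin (λ i → X *ₛ (X *ₛ Q) ^ₛ a i) *ₛ H
        ≈⟨ *ₛ-comm (sumFin (λ i → X *ₛ (X *ₛ Q) ^ₛ a i)) H ⟩
      H *ₛ sumFin (λ i → X *ₛ (X *ₛ Q) ^ₛ a i)
        ≈⟨ *ₛ-sumFin H (λ i → X *ₛ (X *ₛ Q) ^ₛ a i) ⟩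
      sumFin (λ i → H *ₛ (X *ₛ (X *ₛ Q) ^ₛ a i))
        ≈⟨ sumFin-cong (λ i → ≈-trans (*ₛ-comm H (X *ₛ (X *ₛ Q) ^ₛ a i)) (blockTerm-shift i (positive i))) ⟩
      sumFin (λ i → mono 2 1 *ₛ Block (a i ∸ 1)) ∎

strictlyIncreasing⇒injective : ∀ {k} (a : Fin k → ℕ) →
  (∀ i j → i Data.Fin.< j → a i < a j) → ∀ i j → a i ≡ a j → i ≡ j
strictlyIncreasing⇒injective a increasing i j aᵢ≡aⱼ with Data.Fin.Properties.<-cmp i j
... | tri< i<j _ _ = ⊥-elim (Data.Nat.Properties.<-irrefl aᵢ≡aⱼ (increasing i j i<j))
... | tri≈ _ i≡j _ = i≡j
... | tri> _ _ j<i = ⊥-elim (Data.Nat.Properties.<-irrefl (sym aᵢ≡aⱼ) (increasing j i j<i))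

mainTheorem2 : (k : ℕ) → 1 ≤ k → (a : Fin k → ℕ) →
    (∀ i → 1 ≤ a i) → (∀ i j → i Data.Fin.< j → a i < a j) →
    ∀ n m → (V a *ₛ Den a) n m ≡ Num a n m
mainTheorem2 k _ a positive increasing =
  ≈-trans (*ₛ-congʳ (Den a) V≈F)
          (rationalIdentity F H K xqPowers F-equation K-equation
                            (H-equation positive (strictlyIncreasing⇒injective a increasing)))
  where
  open SeriesRing using (≈-trans; *ₛ-congʳ)
  open SeriesAlgebra using (rationalIdentity)
  open SinglePart using (K; K-equation)
  open FunctionalEquations a
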